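{- Let $T$ be the $2$-colored graph on vertex set $\{1,2,3,4\}$ with red edges $\{12,13,34\}$ and blue edges $\{12,23,34\}$. For every positive integer $n$, every $T$-free $2$-colored graph $G$ on $n$ vertices satisfies $|E_r(G)|+|E_b(G)|\le\binom{n+1}{2}$. Consequently $\pi(T)=1$, i.e. $T$ is degenerate.
   Context: A $2$-colored graph is $G=(V,E_r,E_b)$ with $E_r,E_b\subseteq\binom{V}{2}$ (not necessarily disjoint). $G$ is $T$-free if it contains no sub-graph isomorphic to $T$ (red edges into red, blue edges into blue). For $G$ on $n$ vertices $h_n(G)=(|E_r(G)|+|E_b(G)|)/\binom{n}{2}$, and $\pi(H)=\lim_{n\to\infty}\max h_n(G_n)$ over $H$-free $2$-colored graphs $G_n$ on $n$ vertices; $H$ is degenerate if $\pi(H)=1$. -}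

module Defs where

open import Data.Bool using (Bool; true; false; if_then_else_; _∧_)
open import Data.Nat using (ℕ; zero; suc; _<ᵇ_)
open import Data.Fin using (Fin; zero; suc; toℕ)
open import Data.List using (List; map; allFin)
open import Data.Nat.ListAction using (sum)
open import Data.Product using (Σ; _×_; _,_; ∃-syntax)
open import Data.Integer using (+_)
open import Data.Rational using (ℚ; _/_; _≤_)
open import Function.Definitions using (Injective)
open import Relation.Binary.PropositionalEquality using (_≡_; refl)
open import Relation.Nullary using (¬_)

-- A 2-colored graph on vertex set Fin n: red and blue edge sets given as
-- symmetric, irreflexive Boolean adjacency relations (E_r and E_b may overlap).
record Graph2 (n : ℕ) : Set where
  field
    red  : Fin n → Fin n → Bool
    blue : Fin n → Fin n → Bool
    red-sym   : ∀ i j → red i j ≡ red j i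
    blue-sym  : ∀ i j → blue i j ≡ blue j i
    red-irr   : ∀ i → red i i ≡ false
    blue-irr  : ∀ i → blue i i ≡ false
open Graph2 public

edgeCount : {n : ℕ} → (Fin n → Fin n → Bool) → ℕ
edgeCount {n} r =
  sum (map (λ i → sum (map (λ j → if (toℕ i <ᵇ toℕ j) ∧ r i j then 1 else 0)
                           (allFin n)))
           (allFin n))

totalEdges : {n : ℕ} → Graph2 n → ℕ
totalEdges G = edgeCount (red G) Data.Nat.+ edgeCount (blue G)

Contains : {m n : ℕ} → Graph2 m → Graph2 n → Set
Contains {m} {n} H G =
  Σ (Fin m → Fin n) λ f →
    Injective _≡_ _≡_ f ×
    (∀ u v → red H u v ≡ true → red G (f u) (f v) ≡ true) ×
    (∀ u v → blue H u v ≡ true → blue G (f u) (f v) ≡ true)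

Free : {m n : ℕ} → Graph2 m → Graph2 n → Set
Free H G = ¬ Contains H G

-- The graph T on {1,2,3,4} (vertex k is Fin index k-1):
-- red edges 12, 13, 34 ; blue edges 12, 23, 34.
redT : Fin 4 → Fin 4 → Bool
redT zero (suc zero) = true
redT (suc zero) zero = true
redT zero (suc (suc zero)) = true
redT (suc (suc zero)) zero = true
redT (suc (suc zero)) (suc (suc (suc zero))) = true
redT (suc (suc (suc zero))) (suc (suc zero)) = true
redT _ _ = false

blueT : Fin 4 → Fin 4 → Bool
blueT zero (suc zero) = true
blueT (suc zero) zero = true
blueT (suc zero) (suc (suc zero)) = true
blueT (suc (suc zero)) (suc zero) = true
blueT (suc (suc zero)) (suc (suc (suc zero))) = true
blueT (suc (suc (suc zero))) (suc (suc zero)) = true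
blueT _ _ = false

private
  f0 f1 f2 f3 : Fin 4
  f0 = zero
  f1 = suc zero
  f2 = suc (suc zero)
  f3 = suc (suc (suc zero))

symT : (b : Fin 4 → Fin 4 → Bool) →
       b f0 f1 ≡ b f1 f0 → b f0 f2 ≡ b f2 f0 → b f0 f3 ≡ b f3 f0 →
       b f1 f2 ≡ b f2 f1 → b f1 f3 ≡ b f3 f1 → b f2 f3 ≡ b f3 f2 →
       ∀ i j → b i j ≡ b j i
symT b p01 p02 p03 p12 p13 p23 = go
  where
  open import Relation.Binary.PropositionalEquality using (sym)
  go : ∀ i j → b i j ≡ b j i
  go zero zero = refl
  go zero (suc zero) = p01
  go zero (suc (suc zero)) = p02
  go zero (suc (suc (suc zero))) = p03
  go (suc zero) zero = sym p01
  go (suc zero) (suc zero) = refl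
  go (suc zero) (suc (suc zero)) = p12
  go (suc zero) (suc (suc (suc zero))) = p13
  go (suc (suc zero)) zero = sym p02
  go (suc (suc zero)) (suc zero) = sym p12
  go (suc (suc zero)) (suc (suc zero)) = refl
  go (suc (suc zero)) (suc (suc (suc zero))) = p23
  go (suc (suc (suc zero))) zero = sym p03
  go (suc (suc (suc zero))) (suc zero) = sym p13
  go (suc (suc (suc zero))) (suc (suc zero)) = sym p23
  go (suc (suc (suc zero))) (suc (suc (suc zero))) = refl

irrT : (b : Fin 4 → Fin 4 → Bool) →
       b f0 f0 ≡ false → b f1 f1 ≡ false → b f2 f2 ≡ false → b f3 f3 ≡ false →
       ∀ i → b i i ≡ false
irrT b p0 p1 p2 p3 zero = p0
irrT b p0 p1 p2 p3 (suc zero) = p1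
irrT b p0 p1 p2 p3 (suc (suc zero)) = p2
irrT b p0 p1 p2 p3 (suc (suc (suc zero))) = p3

T : Graph2 4
T = record
  { red = redT ; blue = blueT
  ; red-sym = symT redT refl refl refl refl refl refl
  ; blue-sym = symT blueT refl refl refl refl refl refl
  ; red-irr = irrT redT refl refl refl refl
  ; blue-irr = irrT blueT refl refl refl refl }

ℕtoℚ : ℕ → ℚ
ℕtoℚ k = (+ k) / 1

-- π(H) = L, unfolded: lim_{n→∞} max_{G H-free on n vertices} h_n(G) = L, where
-- h_n(G) = (|E_r|+|E_b|)/C(n,2).  For n ≥ 2 the inequalities are multiplied
-- through by C(n,2) > 0; the max over the finite set of H-free graphs is
-- expressed by "every H-free G is ≤ L+ε" and "some H-free G is ≥ L-ε".
open import Data.Nat.Combinatorics using (_C_)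
open import Data.Rational using (0ℚ; _<_; _+_; _-_; _*_)

TuranDensityIs : {m : ℕ} → Graph2 m → ℚ → Set
TuranDensityIs H L =
  ∀ (ε : ℚ) → 0ℚ < ε →
    ∃[ N ] ∀ (n : ℕ) → N Data.Nat.≤ n →
      (2 Data.Nat.≤ n) ×
      (∀ (G : Graph2 n) → Free H G →
         ℕtoℚ (totalEdges G) ≤ (L + ε) * ℕtoℚ (n C 2)) ×
      (Σ (Graph2 n) λ G → Free H G ×
         ((L - ε) * ℕtoℚ (n C 2) ≤ ℕtoℚ (totalEdges G)))

Degenerate : {m : ℕ} → Graph2 m → Set
Degenerate H = TuranDensityIs H (ℕtoℚ 1)

{-# OPTIONS --safe #-}
-- Call a pair double when it is both red and blue. T consists of the disjoint double
-- edges 12 and 34 joined by a red edge 13 and a blue edge 23, so in a T-free graph the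
-- ends a, c of a double path a b c d (with a, b ≠ d) are not adjacent at all.
--
-- The red-plus-blue degrees sum to twice the number of edges; we show by deleting
-- vertices that this sum is at most n (n + 1) = 2 C(n+1,2). Let m have the fewest
-- double neighbours (ddeg). With at most one of them, deg m ≤ n. With two, x and y,
-- where xy is not double, every double neighbour of x other than m and y is a
-- non-neighbour of m, so deg m + ddeg x ≤ n + ddeg m ≤ n + ddeg x. Otherwise m x y is
-- a double triangle, which no double edge leaves; deleting its three vertices one after
-- the other removes degrees at most n + 1, n - 1 and n - 3.
--
-- For degeneracy, the complete red graph is T-free with C(n,2) edges, while
-- C(n+1,2) = n + C(n,2) and n is small compared to C(n,2).
module Submission where

open import Defs
open import Data.Nat.Properties hiding (_≟_)
open import Algebra.Properties.CommutativeMonoid.Sum +-0-commutativeMonoid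
  using (sum; sum-syntax; sum-remove; ∑-distrib-+; ∑-comm; sum-replicate-zero; sum-cong-≗)
open import Data.Bool using (Bool; true; false; if_then_else_; _∧_; not)
open import Data.Bool.Properties using () renaming (_≟_ to _≟ᵇ_)
open import Data.Fin using (Fin; zero; suc; toℕ; punchIn; _≟_)
open import Data.Fin.Patterns using (0F; 1F; 2F; 3F)
open import Data.Fin.Properties
  using (toℕ-injective; punchIn-injective; punchInᵢ≢i; punchIn-punchOut; any?)
open import Data.Integer using (+0; +[1+_]; -[1+_]; +<+)
open import Data.List using ([]; _∷_; map; allFin; tabulate)
open import Data.List.Extrema ≤-totalOrder using (argmin; f[argmin]≤f[xs])
open import Data.List.Membership.Propositional.Properties using (∈-allFin)
open import Data.List.Properties using (map-tabulate)
import Data.List.Relation.Unary.All as All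
open import Data.Nat using (ℕ; zero; suc; _+_; _*_; _≤_; _<_; _<ᵇ_; z≤n; s≤s)
open import Data.Nat.Combinatorics using (_C_; nCk+nC[k+1]≡[n+1]C[k+1]; nC1≡n)
open import Data.Nat.Coprimality using (Coprime)
open import Data.Nat.Induction using (<-rec)
import Data.Nat.ListAction as List
open import Data.Nat.Tactic.RingSolver using (solve)
open import Data.Product using (Σ-syntax; _×_; _,_; proj₁; proj₂)
open import Data.Rational as ℚ using (mkℚ; 1ℚ; 0ℚ; toℚᵘ; NonNegative)
import Data.Rational.Properties as ℚ
open import Data.Rational.Unnormalised as ℚᵘ using (mkℚᵘ; *≤*; 1ℚᵘ)
  renaming (_≃_ to _≃ᵘ_; _≤_ to _≤ᵘ_)
import Data.Rational.Unnormalised.Properties as ℚᵘ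
open import Data.Sum using (_⊎_; inj₁; inj₂)
open import Function using (_∘_; case_of_)
open import Relation.Binary.PropositionalEquality
open import Relation.Nullary using (¬?; yes; no; contradiction)
open import Relation.Nullary.Decidable
  using (does; _×-dec_; decidable-stable; dec-true; dec-false)
open import Relation.Nullary.Reflects using (ofʸ; ofⁿ)

𝟙 : Bool → ℕ
𝟙 b = if b then 1 else 0

∑-mono-≤ : ∀ {n} {f g : Fin n → ℕ} → (∀ i → f i ≤ g i) → sum f ≤ sum g
∑-mono-≤ {zero}  _   = z≤n
∑-mono-≤ {suc n} f≤g = +-mono-≤ (f≤g zero) (∑-mono-≤ (f≤g ∘ suc))

∑-const : ∀ n c → ∑[ i < n ] c ≡ n * c
∑-const zero    c = refl
∑-const (suc n) c = cong (c +_) (∑-const n c)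

listSum-tabulate : ∀ {n} (f : Fin n → ℕ) → List.sum (tabulate f) ≡ sum f
listSum-tabulate {zero}  f = refl
listSum-tabulate {suc n} f = cong (f zero +_) (listSum-tabulate (f ∘ suc))

listSum-allFin : ∀ {n} (f : Fin n → ℕ) → List.sum (map f (allFin n)) ≡ sum f
listSum-allFin f = trans (cong List.sum (map-tabulate (λ i → i) f)) (listSum-tabulate f)

δ : ∀ {n} → Fin n → Fin n → ℕ
δ zero    zero    = 1
δ zero    (suc _) = 0
δ (suc _) zero    = 0
δ (suc i) (suc j) = δ i j

δ-diag : ∀ {n} (i : Fin n) → δ i i ≡ 1
δ-diag zero    = refl
δ-diag (suc i) = δ-diag i

∑-δ : ∀ {n} (i : Fin n) → sum (δ i) ≡ 1
∑-δ {suc n} zero    = cong suc (sum-replicate-zero n)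
∑-δ {suc n} (suc i) = ∑-δ i

𝟙-≤-δ : ∀ {n} {b} {i j : Fin n} → (b ≡ true → j ≡ i) → 𝟙 b ≤ δ i j
𝟙-≤-δ {b = false} _    = z≤n
𝟙-≤-δ {b = true}  {i} j≡i = subst (λ j → 1 ≤ δ i j) (sym (j≡i refl)) (≤-reflexive (sym (δ-diag i)))

-- Degrees and the handshake lemma

forwardEdge : ∀ {n} → (Fin n → Fin n → Bool) → Fin n → Fin n → ℕ
forwardEdge r i j = 𝟙 ((toℕ i <ᵇ toℕ j) ∧ r i j)

edgeCount-as-∑ : ∀ {n} (r : Fin n → Fin n → Bool) →
  edgeCount r ≡ ∑[ i < n ] ∑[ j < n ] forwardEdge r i j
edgeCount-as-∑ {n} r =
  trans (listSum-allFin (λ i → List.sum (map (forwardEdge r i) (allFin n))))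
        (sum-cong-≗ (λ i → listSum-allFin (forwardEdge r i)))

forwardEdge-+-backward : ∀ {n} (r : Fin n → Fin n → Bool) →
  (∀ i j → r i j ≡ r j i) → (∀ i → r i i ≡ false) →
  ∀ i j → forwardEdge r i j + forwardEdge r j i ≡ 𝟙 (r i j)
forwardEdge-+-backward r r-sym r-irr i j
  with toℕ i <ᵇ toℕ j | <ᵇ-reflects-< (toℕ i) (toℕ j)
     | toℕ j <ᵇ toℕ i | <ᵇ-reflects-< (toℕ j) (toℕ i)
... | true  | ofʸ i<j | true  | ofʸ j<i = contradiction j<i (<-asym i<j)
... | true  | _       | false | _       = +-identityʳ _
... | false | _       | true  | _       = cong 𝟙 (r-sym j i)
... | false | ofⁿ i≮j | false | ofⁿ j≮i
  with toℕ-injective (≤-antisym (≮⇒≥ j≮i) (≮⇒≥ i≮j))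
...   | refl = cong 𝟙 (sym (r-irr i))

edgeCount-handshake : ∀ {n} (r : Fin n → Fin n → Bool) →
  (∀ i j → r i j ≡ r j i) → (∀ i → r i i ≡ false) →
  2 * edgeCount r ≡ ∑[ i < n ] ∑[ j < n ] 𝟙 (r i j)
edgeCount-handshake {n} r r-sym r-irr = begin
  2 * edgeCount r
    ≡⟨ cong (λ e → e + (e + 0)) (edgeCount-as-∑ r) ⟩
  F + (F + 0)
    ≡⟨ cong (F +_) (trans (+-identityʳ F) (∑-comm (forwardEdge r))) ⟩
  F + ∑[ i < n ] ∑[ j < n ] forwardEdge r j i
    ≡⟨ ∑-distrib-+ (λ i → ∑[ j < n ] forwardEdge r i j) (λ i → ∑[ j < n ] forwardEdge r j i) ⟨
  ∑[ i < n ] (∑[ j < n ] forwardEdge r i j + ∑[ j < n ] forwardEdge r j i)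
    ≡⟨ sum-cong-≗ (λ i → ∑-distrib-+ (forwardEdge r i) (λ j → forwardEdge r j i)) ⟨
  ∑[ i < n ] ∑[ j < n ] (forwardEdge r i j + forwardEdge r j i)
    ≡⟨ sum-cong-≗ (λ i → sum-cong-≗ (forwardEdge-+-backward r r-sym r-irr i)) ⟩
  ∑[ i < n ] ∑[ j < n ] 𝟙 (r i j) ∎
  where
  open ≡-Reasoning
  F : ℕ
  F = ∑[ i < n ] ∑[ j < n ] forwardEdge r i j

weight : ∀ {n} → Graph2 n → Fin n → Fin n → ℕ
weight G i j = 𝟙 (red G i j) + 𝟙 (blue G i j)

weight-sym : ∀ {n} (G : Graph2 n) i j → weight G i j ≡ weight G j i
weight-sym G i j = cong₂ _+_ (cong 𝟙 (red-sym G i j)) (cong 𝟙 (blue-sym G i j))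

weight-diag : ∀ {n} (G : Graph2 n) i → weight G i i ≡ 0
weight-diag G i = cong₂ _+_ (cong 𝟙 (red-irr G i)) (cong 𝟙 (blue-irr G i))

degree : ∀ {n} → Graph2 n → Fin n → ℕ
degree {n} G v = ∑[ j < n ] weight G v j

degreeSum : ∀ {n} → Graph2 n → ℕ
degreeSum {n} G = ∑[ v < n ] degree G v

handshake : ∀ {n} (G : Graph2 n) → 2 * totalEdges G ≡ degreeSum G
handshake {n} G = begin
  2 * (edgeCount (red G) + edgeCount (blue G))
    ≡⟨ *-distribˡ-+ 2 (edgeCount (red G)) _ ⟩
  2 * edgeCount (red G) + 2 * edgeCount (blue G)
    ≡⟨ cong₂ _+_ (edgeCount-handshake (red G) (red-sym G) (red-irr G))
                 (edgeCount-handshake (blue G) (blue-sym G) (blue-irr G)) ⟩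
  ∑[ i < n ] ∑[ j < n ] 𝟙 (red G i j) + ∑[ i < n ] ∑[ j < n ] 𝟙 (blue G i j)
    ≡⟨ ∑-distrib-+ (λ i → ∑[ j < n ] 𝟙 (red G i j)) _ ⟨
  ∑[ i < n ] (∑[ j < n ] 𝟙 (red G i j) + ∑[ j < n ] 𝟙 (blue G i j))
    ≡⟨ sum-cong-≗ (λ i → ∑-distrib-+ (λ j → 𝟙 (red G i j)) _) ⟨
  degreeSum G ∎
  where open ≡-Reasoning

removeVertex : ∀ {n} → Graph2 (suc n) → Fin (suc n) → Graph2 n
removeVertex G v = record
  { red      = λ i j → red G (punchIn v i) (punchIn v j)
  ; blue     = λ i j → blue G (punchIn v i) (punchIn v j)
  ; red-sym  = λ i j → red-sym G (punchIn v i) (punchIn v j)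
  ; blue-sym = λ i j → blue-sym G (punchIn v i) (punchIn v j)
  ; red-irr  = λ i → red-irr G (punchIn v i)
  ; blue-irr = λ i → blue-irr G (punchIn v i)
  }

degree-punchIn : ∀ {n} (G : Graph2 (suc n)) v →
  degree G v ≡ ∑[ j < n ] weight G v (punchIn v j)
degree-punchIn {n} G v = trans (sum-remove {i = v} (weight G v)) (cong (_+ ∑[ j < n ] weight G v (punchIn v j)) (weight-diag G v))

degreeSum-removeVertex : ∀ {n} (G : Graph2 (suc n)) v →
  degreeSum G ≡ 2 * degree G v + degreeSum (removeVertex G v)
degreeSum-removeVertex {n} G v = begin
  degreeSum G
    ≡⟨ sum-remove {i = v} (degree G) ⟩
  degree G v + ∑[ i < n ] degree G (punchIn v i)
    ≡⟨ cong (degree G v +_) (sum-cong-≗ (λ i → sum-remove {i = v} (weight G (punchIn v i)))) ⟩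
  degree G v + ∑[ i < n ] (weight G (punchIn v i) v + degree G′ i)
    ≡⟨ cong (degree G v +_) (∑-distrib-+ (λ i → weight G (punchIn v i) v) (degree G′)) ⟩
  degree G v + (∑[ i < n ] weight G (punchIn v i) v + degreeSum G′)
    ≡⟨ cong (λ d → degree G v + (d + degreeSum G′)) back-edges ⟩
  degree G v + (degree G v + degreeSum G′)
    ≡⟨ +-assoc (degree G v) _ _ ⟨
  degree G v + degree G v + degreeSum G′
    ≡⟨ cong (λ d → degree G v + d + degreeSum G′) (+-identityʳ (degree G v)) ⟨
  2 * degree G v + degreeSum G′ ∎
  where
  open ≡-Reasoning
  G′ : Graph2 n
  G′ = removeVertex G v
  back-edges : ∑[ i < n ] weight G (punchIn v i) v ≡ degree G v
  back-edges = trans (sum-cong-≗ (λ i → weight-sym G (punchIn v i) v)) (sym (degree-punchIn G v))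

-- Double edges

red⇒≢ : ∀ {n} (G : Graph2 n) {i j} → red G i j ≡ true → i ≢ j
red⇒≢ G {i} ij refl = contradiction (trans (sym ij) (red-irr G i)) λ ()

blue⇒≢ : ∀ {n} (G : Graph2 n) {i j} → blue G i j ≡ true → i ≢ j
blue⇒≢ G {i} ij refl = contradiction (trans (sym ij) (blue-irr G i)) λ ()

∧-true : ∀ {x y} → x ∧ y ≡ true → x ≡ true × y ≡ true
∧-true {true} {true} refl = refl , refl

double : ∀ {n} → Graph2 n → Fin n → Fin n → Bool
double G i j = red G i j ∧ blue G i j

module _ {n} (G : Graph2 n) {i j : Fin n} (ij : double G i j ≡ true) where

  double⇒red : red G i j ≡ true
  double⇒red = proj₁ (∧-true ij)

  double⇒blue : blue G i j ≡ true
  double⇒blue = proj₂ (∧-true ij)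

  double⇒≢ : i ≢ j
  double⇒≢ = red⇒≢ G double⇒red

  double-sym : double G j i ≡ true
  double-sym = trans (cong₂ _∧_ (red-sym G j i) (blue-sym G j i)) ij

  double⇒weight≡2 : weight G i j ≡ 2
  double⇒weight≡2 = cong₂ _+_ (cong 𝟙 double⇒red) (cong 𝟙 double⇒blue)

weight-≤-1+double : ∀ {n} (G : Graph2 n) i j → weight G i j ≤ 1 + 𝟙 (double G i j)
weight-≤-1+double G i j with red G i j | blue G i j
... | true  | true  = ≤-refl
... | true  | false = ≤-refl
... | false | true  = ≤-refl
... | false | false = z≤n

doubleDegree : ∀ {n} → Graph2 n → Fin n → ℕ
doubleDegree {n} G v = ∑[ j < n ] 𝟙 (double G v j)

degree-≤ : ∀ {n} (G : Graph2 (suc n)) v (s : Fin (suc n) → ℕ) →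
  (∀ j → 𝟙 (double G v j) ≤ s j) → degree G v ≤ n + sum s
degree-≤ {n} G v s double≤s = begin
  degree G v
    ≡⟨ degree-punchIn G v ⟩
  ∑[ j < n ] weight G v (punchIn v j)
    ≤⟨ ∑-mono-≤ (λ j → ≤-trans (weight-≤-1+double G v (punchIn v j)) (+-monoʳ-≤ 1 (double≤s (punchIn v j)))) ⟩
  ∑[ j < n ] (1 + s (punchIn v j))
    ≡⟨ ∑-distrib-+ (λ _ → 1) (s ∘ punchIn v) ⟩
  ∑[ j < n ] 1 + ∑[ j < n ] s (punchIn v j)
    ≡⟨ cong (_+ ∑[ j < n ] s (punchIn v j)) (trans (∑-const n 1) (*-identityʳ n)) ⟩
  n + ∑[ j < n ] s (punchIn v j)
    ≤⟨ +-monoʳ-≤ n (m≤n+m _ (s v)) ⟩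
  n + (s v + ∑[ j < n ] s (punchIn v j))
    ≡⟨ cong (n +_) (sum-remove {i = v} s) ⟨
  n + sum s ∎
  where open ≤-Reasoning

module _ {n} (G : Graph2 (suc n)) (v : Fin (suc n)) where

  degree-≤-noDoubleNbr : (∀ j → double G v j ≢ true) → degree G v ≤ n
  degree-≤-noDoubleNbr none = ≤-trans (degree-≤ G v (λ _ → 0) 𝟙≤0)
    (≤-reflexive (trans (cong (n +_) (sum-replicate-zero (suc n))) (+-identityʳ n)))
    where
    𝟙≤0 : ∀ j → 𝟙 (double G v j) ≤ 0
    𝟙≤0 j with double G v j in vj
    ... | true  = contradiction vj (none j)
    ... | false = z≤n

  degree-≤-oneDoubleNbr : ∀ x → (∀ j → double G v j ≡ true → j ≡ x) → degree G v ≤ n + 1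
  degree-≤-oneDoubleNbr x only-x =
    ≤-trans (degree-≤ G v (δ x) (λ j → 𝟙-≤-δ (only-x j))) (≤-reflexive (cong (n +_) (∑-δ x)))

  degree-≤-twoDoubleNbrs : ∀ x y → (∀ j → double G v j ≡ true → j ≡ x ⊎ j ≡ y) →
    degree G v ≤ n + 2
  degree-≤-twoDoubleNbrs x y only-xy =
    ≤-trans (degree-≤ G v (λ j → δ x j + δ y j) 𝟙≤δ+δ)
      (≤-reflexive (cong (n +_) (trans (∑-distrib-+ (δ x) (δ y)) (cong₂ _+_ (∑-δ x) (∑-δ y)))))
    where
    𝟙≤δ+δ : ∀ j → 𝟙 (double G v j) ≤ δ x j + δ y j
    𝟙≤δ+δ j with double G v j in vj
    ... | false = z≤n
    ... | true with only-xy j vj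
    ...   | inj₁ refl = ≤-trans (≤-reflexive (sym (δ-diag x))) (m≤m+n _ _)
    ...   | inj₂ refl = ≤-trans (≤-reflexive (sym (δ-diag y))) (m≤n+m _ _)

-- Copies of T

T-copy : ∀ {n} (G : Graph2 n) {p q c d : Fin n} →
  double G p q ≡ true → double G c d ≡ true → red G p c ≡ true → blue G q c ≡ true →
  p ≢ d → q ≢ d → Contains T G
T-copy {n} G {p} {q} {c} {d} pq cd pc qc p≢d q≢d = f , f-injective , f-red , f-blue
  where
  f : Fin 4 → Fin n
  f 0F = p
  f 1F = q
  f 2F = c
  f 3F = d

  f-injective : ∀ {x y} → f x ≡ f y → x ≡ y
  f-injective {0F} {0F} _ = refl
  f-injective {0F} {1F} e = contradiction e (double⇒≢ G pq)
  f-injective {0F} {2F} e = contradiction e (red⇒≢ G pc)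
  f-injective {0F} {3F} e = contradiction e p≢d
  f-injective {1F} {0F} e = contradiction (sym e) (double⇒≢ G pq)
  f-injective {1F} {1F} _ = refl
  f-injective {1F} {2F} e = contradiction e (blue⇒≢ G qc)
  f-injective {1F} {3F} e = contradiction e q≢d
  f-injective {2F} {0F} e = contradiction (sym e) (red⇒≢ G pc)
  f-injective {2F} {1F} e = contradiction (sym e) (blue⇒≢ G qc)
  f-injective {2F} {2F} _ = refl
  f-injective {2F} {3F} e = contradiction e (double⇒≢ G cd)
  f-injective {3F} {0F} e = contradiction (sym e) p≢d
  f-injective {3F} {1F} e = contradiction (sym e) q≢d
  f-injective {3F} {2F} e = contradiction (sym e) (double⇒≢ G cd)
  f-injective {3F} {3F} _ = refl

  f-red : ∀ u v → red T u v ≡ true → red G (f u) (f v) ≡ true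
  f-red 0F 1F _ = double⇒red G pq
  f-red 1F 0F _ = double⇒red G (double-sym G pq)
  f-red 0F 2F _ = pc
  f-red 2F 0F _ = trans (red-sym G c p) pc
  f-red 2F 3F _ = double⇒red G cd
  f-red 3F 2F _ = double⇒red G (double-sym G cd)
  f-red 0F 0F ()
  f-red 0F 3F ()
  f-red 1F (suc _) ()
  f-red 2F 1F ()
  f-red 2F 2F ()
  f-red 3F 0F ()
  f-red 3F 1F ()
  f-red 3F 3F ()

  f-blue : ∀ u v → blue T u v ≡ true → blue G (f u) (f v) ≡ true
  f-blue 0F 1F _ = double⇒blue G pq
  f-blue 1F 0F _ = double⇒blue G (double-sym G pq)
  f-blue 1F 2F _ = qc
  f-blue 2F 1F _ = trans (blue-sym G c q) qc
  f-blue 2F 3F _ = double⇒blue G cd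
  f-blue 3F 2F _ = double⇒blue G (double-sym G cd)
  f-blue 0F 0F ()
  f-blue 0F (suc (suc _)) ()
  f-blue 1F 1F ()
  f-blue 1F 3F ()
  f-blue 2F 0F ()
  f-blue 2F 2F ()
  f-blue 3F 0F ()
  f-blue 3F 1F ()
  f-blue 3F 3F ()

doublePath⇒nonadjacent : ∀ {n} (G : Graph2 n) → Free T G → {a b c d : Fin n} →
  double G a b ≡ true → double G b c ≡ true → double G c d ≡ true → a ≢ d → b ≢ d →
  weight G a c ≡ 0
doublePath⇒nonadjacent G free {a} {b} {c} ab bc cd a≢d b≢d
  with red G a c in ac | blue G a c in ac′
... | true  | _     = contradiction (T-copy G ab cd ac (double⇒blue G bc) a≢d b≢d) free
... | false | true  = contradiction (T-copy G (double-sym G ab) cd (double⇒red G bc) ac′ b≢d a≢d) free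
... | false | false = refl

DoubleTriangle : ∀ {n} → Graph2 n → Set
DoubleTriangle {n} G = Σ[ a ∈ Fin n ] Σ[ b ∈ Fin n ] Σ[ c ∈ Fin n ]
  double G a b ≡ true × double G b c ≡ true × double G a c ≡ true

doubleTriangle-closed : ∀ {n} (G : Graph2 n) → Free T G → {a b c : Fin n} →
  double G a b ≡ true → double G b c ≡ true → double G a c ≡ true →
  ∀ j → double G a j ≡ true → j ≡ b ⊎ j ≡ c
doubleTriangle-closed G free {a} {b} {c} ab bc ac j aj with j ≟ b | j ≟ c
... | yes j≡b | _       = inj₁ j≡b
... | no  _   | yes j≡c = inj₂ j≡c
... | no  j≢b | no  j≢c = contradiction
  (trans (sym (double⇒weight≡2 G (double-sym G ac)))
    (doublePath⇒nonadjacent G free (double-sym G bc) (double-sym G ab) aj (j≢c ∘ sym) (j≢b ∘ sym)))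
  λ ()

free-removeVertex : ∀ {m n} (H : Graph2 m) (G : Graph2 (suc n)) v → Free H G → Free H (removeVertex G v)
free-removeVertex H G v free (f , f-injective , f-red , f-blue) =
  free (punchIn v ∘ f , f-injective ∘ punchIn-injective v _ _ , f-red , f-blue)

-- The degree sum of a T-free graph

minimiser : ∀ {n} (f : Fin (suc n) → ℕ) → Σ[ v ∈ Fin (suc n) ] (∀ u → f v ≤ f u)
minimiser {n} f = argmin f zero (allFin (suc n)) ,
  λ u → All.lookup (f[argmin]≤f[xs] {f = f} zero (allFin (suc n))) (∈-allFin u)

minimalDoubleDegree⇒lowDegree : ∀ {n} (G : Graph2 (suc n)) → Free T G → {m x y : Fin (suc n)} →
  (∀ u → doubleDegree G m ≤ doubleDegree G u) →
  double G m x ≡ true → double G m y ≡ true → x ≢ y → double G x y ≢ true →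
  degree G m ≤ suc n
minimalDoubleDegree⇒lowDegree {n} G free {m} {x} {y} m-min mx my x≢y ¬xy =
  +-cancelʳ-≤ (doubleDegree G x) (degree G m) (suc n) (begin
    degree G m + doubleDegree G x
      ≡⟨ ∑-distrib-+ (weight G m) (λ j → 𝟙 (double G x j)) ⟨
    ∑[ j < suc n ] (weight G m j + 𝟙 (double G x j))
      ≤⟨ ∑-mono-≤ pointwise ⟩
    ∑[ j < suc n ] (1 + 𝟙 (double G m j))
      ≡⟨ ∑-distrib-+ (λ _ → 1) (λ j → 𝟙 (double G m j)) ⟩
    ∑[ j < suc n ] 1 + doubleDegree G m
      ≡⟨ cong (_+ doubleDegree G m) (trans (∑-const (suc n) 1) (*-identityʳ (suc n))) ⟩
    suc n + doubleDegree G m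
      ≤⟨ +-monoʳ-≤ (suc n) (m-min x) ⟩
    suc n + doubleDegree G x ∎)
  where
  open ≤-Reasoning
  -- a double neighbour j ∉ {m, y} of x is not adjacent to m, by the double path j x m y
  pointwise : ∀ j → weight G m j + 𝟙 (double G x j) ≤ 1 + 𝟙 (double G m j)
  pointwise j with double G x j in xj
  ... | false = ≤-trans (≤-reflexive (+-identityʳ _)) (weight-≤-1+double G m j)
  ... | true with j ≟ m | j ≟ y
  ...   | yes refl | _        = ≤-trans (≤-reflexive (cong (_+ 1) (weight-diag G m))) (s≤s z≤n)
  ...   | no _     | yes refl = contradiction xj ¬xy
  ...   | no j≢m   | no j≢y   = ≤-trans (≤-reflexive (cong (_+ 1) mj≡0)) (s≤s z≤n)
    where
    mj≡0 : weight G m j ≡ 0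
    mj≡0 = trans (weight-sym G m j)
      (doublePath⇒nonadjacent G free (double-sym G xj) (double-sym G mx) my j≢y x≢y)

lowDegree-or-twoDoubleNbrs : ∀ {n} (G : Graph2 (suc n)) v →
  degree G v ≤ suc n ⊎ Σ[ x ∈ Fin (suc n) ] Σ[ y ∈ Fin (suc n) ]
    double G v x ≡ true × double G v y ≡ true × x ≢ y
lowDegree-or-twoDoubleNbrs {n} G v with any? (λ j → double G v j ≟ᵇ true)
... | no none = inj₁ (≤-trans (degree-≤-noDoubleNbr G v (λ j vj → none (j , vj))) (n≤1+n n))
... | yes (x , vx) with any? (λ j → (double G v j ≟ᵇ true) ×-dec ¬? (j ≟ x))
...   | yes (y , vy , y≢x) = inj₂ (x , y , vx , vy , y≢x ∘ sym)
...   | no only-x = inj₁ (≤-trans (degree-≤-oneDoubleNbr G v x nbr≡x) (≤-reflexive (+-comm n 1)))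
  where
  nbr≡x : ∀ j → double G v j ≡ true → j ≡ x
  nbr≡x j vj = decidable-stable (j ≟ x) (λ j≢x → only-x (j , vj , j≢x))

lowDegree-or-doubleTriangle : ∀ {n} (G : Graph2 (suc n)) → Free T G →
  (Σ[ v ∈ Fin (suc n) ] degree G v ≤ suc n) ⊎ DoubleTriangle G
lowDegree-or-doubleTriangle {n} G free = atMinimum (minimiser (doubleDegree G))
  where
  atMinimum : Σ[ m ∈ Fin (suc n) ] (∀ u → doubleDegree G m ≤ doubleDegree G u) →
    (Σ[ v ∈ Fin (suc n) ] degree G v ≤ suc n) ⊎ DoubleTriangle G
  atMinimum (m , m-min) with lowDegree-or-twoDoubleNbrs G m
  ... | inj₁ m-low = inj₁ (m , m-low)
  ... | inj₂ (x , y , mx , my , x≢y) with double G x y ≟ᵇ true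
  ...   | yes xy = inj₂ (m , x , y , mx , xy , my)
  ...   | no ¬xy = inj₁ (m , minimalDoubleDegree⇒lowDegree G free m-min mx my x≢y ¬xy)

data Punched {n} (a : Fin (suc n)) : Fin (suc n) → Set where
  punched : ∀ b → Punched a (punchIn a b)

punchIn-view : ∀ {n} {a b : Fin (suc n)} → a ≢ b → Punched a b
punchIn-view a≢b = subst (Punched _) (punchIn-punchOut a≢b) (punched _)

doubleNbrs-removeVertex : ∀ {n} (G : Graph2 (suc n)) v {u w : Fin n} →
  (∀ j → double G (punchIn v u) j ≡ true → j ≡ v ⊎ j ≡ punchIn v w) →
  ∀ j → double (removeVertex G v) u j ≡ true → j ≡ w
doubleNbrs-removeVertex G v only j uj with only (punchIn v j) uj
... | inj₁ j≡v = contradiction j≡v (punchInᵢ≢i v j)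
... | inj₂ j≡w = punchIn-injective v j _ j≡w

DegreeSumBound : ℕ → Set
DegreeSumBound n = (G : Graph2 n) → Free T G → degreeSum G ≤ n * suc n

isolatedDoubleEdge-bound : ∀ {k} → DegreeSumBound k → (G : Graph2 (2 + k)) → Free T G →
  {u w : Fin (2 + k)} → double G u w ≡ true →
  (∀ j → double G u j ≡ true → j ≡ w) → (∀ j → double G w j ≡ true → j ≡ u) →
  degreeSum G + 2 ≤ (2 + k) * (3 + k)
isolatedDoubleEdge-bound {k} ih G free {u} uw u-only w-only with punchIn-view (double⇒≢ G uw)
... | punched w₁ = begin
  degreeSum G + 2
    ≡⟨ cong (_+ 2) (degreeSum-removeVertex G u) ⟩
  2 * degree G u + degreeSum G₁ + 2
    ≡⟨ cong (λ s → 2 * degree G u + s + 2) (degreeSum-removeVertex G₁ w₁) ⟩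
  2 * degree G u + (2 * degree G₁ w₁ + degreeSum G₂) + 2
    ≤⟨ +-monoˡ-≤ 2 (+-mono-≤ (*-monoʳ-≤ 2 u-low) (+-mono-≤ (*-monoʳ-≤ 2 w₁-low) G₂-bound)) ⟩
  2 * (suc k + 1) + (2 * k + k * suc k) + 2
    ≡⟨ solve (k ∷ []) ⟩
  (2 + k) * (3 + k) ∎
  where
  open ≤-Reasoning
  G₁ : Graph2 (suc k)
  G₁ = removeVertex G u
  G₂ : Graph2 k
  G₂ = removeVertex G₁ w₁
  u-low : degree G u ≤ suc k + 1
  u-low = degree-≤-oneDoubleNbr G u _ u-only
  w₁-low : degree G₁ w₁ ≤ k
  w₁-low = degree-≤-noDoubleNbr G₁ w₁ (λ j w₁j → punchInᵢ≢i u j (w-only (punchIn u j) w₁j))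
  G₁-free : Free T G₁
  G₁-free = free-removeVertex T G u free
  G₂-bound : degreeSum G₂ ≤ k * suc k
  G₂-bound = ih G₂ (free-removeVertex T G₁ w₁ G₁-free)

doubleTriangle-bound : ∀ {n} → (∀ {m} → m < n → DegreeSumBound m) →
  (G : Graph2 n) → Free T G → DoubleTriangle G → degreeSum G ≤ n * suc n
doubleTriangle-bound {suc n} ih G free (a , b , c , ab , bc , ac)
  with punchIn-view (double⇒≢ G ab) | punchIn-view (double⇒≢ G ac)
doubleTriangle-bound {suc (suc zero)} ih G free (a , _ , _ , _ , bc , _)
  | punched 0F | punched 0F = contradiction refl (double⇒≢ G bc)
doubleTriangle-bound {suc (suc (suc k))} ih G free (a , _ , _ , ab , bc , ac)
  | punched b₁ | punched c₁ = +-cancelʳ-≤ 2 _ _ (begin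
  degreeSum G + 2
    ≡⟨ cong (_+ 2) (degreeSum-removeVertex G a) ⟩
  2 * degree G a + degreeSum G₁ + 2
    ≡⟨ +-assoc (2 * degree G a) _ 2 ⟩
  2 * degree G a + (degreeSum G₁ + 2)
    ≤⟨ +-mono-≤ (*-monoʳ-≤ 2 a-low) (isolatedDoubleEdge-bound (ih k<n) G₁ G₁-free bc b₁-only c₁-only) ⟩
  2 * (suc (suc k) + 2) + (2 + k) * (3 + k)
    ≡⟨ solve (k ∷ []) ⟩
  (3 + k) * (4 + k) + 2 ∎)
  where
  open ≤-Reasoning
  G₁ : Graph2 (2 + k)
  G₁ = removeVertex G a
  G₁-free : Free T G₁
  G₁-free = free-removeVertex T G a free
  k<n : k < 3 + k
  k<n = m<n+m k (s≤s z≤n)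
  a-low : degree G a ≤ suc (suc k) + 2
  a-low = degree-≤-twoDoubleNbrs G a _ _ (doubleTriangle-closed G free ab bc ac)
  b₁-only : ∀ j → double G₁ b₁ j ≡ true → j ≡ c₁
  b₁-only = doubleNbrs-removeVertex G a
    (doubleTriangle-closed G free (double-sym G ab) ac bc)
  c₁-only : ∀ j → double G₁ c₁ j ≡ true → j ≡ b₁
  c₁-only = doubleNbrs-removeVertex G a
    (doubleTriangle-closed G free (double-sym G ac) ab (double-sym G bc))

lowDegreeVertex-bound : ∀ {n} → DegreeSumBound n → (G : Graph2 (suc n)) → Free T G →
  Σ[ v ∈ Fin (suc n) ] degree G v ≤ suc n → degreeSum G ≤ suc n * suc (suc n)
lowDegreeVertex-bound {n} ih G free (v , v-low) = begin
  degreeSum G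
    ≡⟨ degreeSum-removeVertex G v ⟩
  2 * degree G v + degreeSum (removeVertex G v)
    ≤⟨ +-mono-≤ (*-monoʳ-≤ 2 v-low) (ih (removeVertex G v) (free-removeVertex T G v free)) ⟩
  2 * suc n + n * suc n
    ≡⟨ solve (n ∷ []) ⟩
  suc n * suc (suc n) ∎
  where open ≤-Reasoning

degreeSum-bound : ∀ n → DegreeSumBound n
degreeSum-bound = <-rec DegreeSumBound bound
  where
  bound : ∀ n → (∀ {m} → m < n → DegreeSumBound m) → DegreeSumBound n
  bound zero    _  G _    = z≤n
  bound (suc n) ih G free = case lowDegree-or-doubleTriangle G free of λ where
    (inj₁ lowDegreeVertex) → lowDegreeVertex-bound (ih ≤-refl) G free lowDegreeVertex
    (inj₂ triangle)        → doubleTriangle-bound ih G free triangle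

[1+n]C2≡n+nC2 : ∀ n → suc n C 2 ≡ n + n C 2
[1+n]C2≡n+nC2 n = trans (sym (nCk+nC[k+1]≡[n+1]C[k+1] n 1)) (cong (_+ n C 2) (nC1≡n n))

2*[1+n]C2≡n*[1+n] : ∀ n → 2 * (suc n C 2) ≡ n * suc n
2*[1+n]C2≡n*[1+n] zero    = refl
2*[1+n]C2≡n*[1+n] (suc n) = begin
  2 * (suc (suc n) C 2)       ≡⟨ cong (2 *_) ([1+n]C2≡n+nC2 (suc n)) ⟩
  2 * (suc n + suc n C 2)     ≡⟨ *-distribˡ-+ 2 (suc n) _ ⟩
  2 * suc n + 2 * (suc n C 2) ≡⟨ cong (2 * suc n +_) (2*[1+n]C2≡n*[1+n] n) ⟩
  2 * suc n + n * suc n       ≡⟨ solve (n ∷ []) ⟩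
  suc n * suc (suc n)         ∎
  where open ≡-Reasoning

free⇒totalEdges≤ : ∀ {n} (G : Graph2 n) → Free T G → totalEdges G ≤ suc n C 2
free⇒totalEdges≤ {n} G free = *-cancelˡ-≤ 2 (begin
  2 * totalEdges G   ≡⟨ handshake G ⟩
  degreeSum G        ≤⟨ degreeSum-bound n G free ⟩
  n * suc n          ≡⟨ 2*[1+n]C2≡n*[1+n] n ⟨
  2 * (suc n C 2)    ∎)
  where open ≤-Reasoning

-- Degeneracy

does-≟-sym : ∀ {n} (i j : Fin n) → does (i ≟ j) ≡ does (j ≟ i)
does-≟-sym i j with i ≟ j
... | yes refl = sym (dec-true (i ≟ i) refl)
... | no  i≢j  = sym (dec-false (j ≟ i) (i≢j ∘ sym))

completeRed : ∀ n → Graph2 n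
completeRed n = record
  { red      = λ i j → not (does (i ≟ j))
  ; blue     = λ _ _ → false
  ; red-sym  = λ i j → cong not (does-≟-sym i j)
  ; blue-sym = λ _ _ → refl
  ; red-irr  = λ i → cong not (dec-true (i ≟ i) refl)
  ; blue-irr = λ _ → refl
  }

completeRed-free : ∀ n → Free T (completeRed n)
completeRed-free n (_ , _ , _ , f-blue) = contradiction (f-blue 0F 1F refl) λ ()

weight-completeRed : ∀ {m} (v : Fin (suc m)) j → weight (completeRed (suc m)) v (punchIn v j) ≡ 1
weight-completeRed v j with v ≟ punchIn v j
... | yes v≡ = contradiction (sym v≡) (punchInᵢ≢i v j)
... | no  _  = refl

degree-completeRed : ∀ {m} (v : Fin (suc m)) → degree (completeRed (suc m)) v ≡ m
degree-completeRed {m} v = begin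
  degree (completeRed (suc m)) v                              ≡⟨ degree-punchIn (completeRed (suc m)) v ⟩
  ∑[ j < m ] weight (completeRed (suc m)) v (punchIn v j)     ≡⟨ sum-cong-≗ (weight-completeRed v) ⟩
  ∑[ j < m ] 1                                                ≡⟨ ∑-const m 1 ⟩
  m * 1                                                       ≡⟨ *-identityʳ m ⟩
  m                                                           ∎
  where open ≡-Reasoning

totalEdges-completeRed : ∀ m → totalEdges (completeRed (suc m)) ≡ suc m C 2
totalEdges-completeRed m = *-cancelˡ-≡ _ _ 2 (begin
  2 * totalEdges (completeRed (suc m))   ≡⟨ handshake (completeRed (suc m)) ⟩
  degreeSum (completeRed (suc m))        ≡⟨ sum-cong-≗ (degree-completeRed {m}) ⟩
  ∑[ v < suc m ] m                       ≡⟨ ∑-const (suc m) m ⟩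
  suc m * m                              ≡⟨ *-comm (suc m) m ⟩
  m * suc m                              ≡⟨ 2*[1+n]C2≡n*[1+n] m ⟨
  2 * (suc m C 2)                        ∎)
  where open ≡-Reasoning

module _ where
  open import Data.Integer using (+_; +≤+) renaming (_+_ to _+ℤ_; _*_ to _*ℤ_)
  open import Data.Integer.Properties as ℤ using (pos-+; pos-*)

  toℚᵘ-ℕtoℚ : ∀ n → toℚᵘ (ℕtoℚ n) ≃ᵘ mkℚᵘ (+ n) 0
  toℚᵘ-ℕtoℚ n = ℚ.toℚᵘ-fromℚᵘ (mkℚᵘ (+ n) 0)

  -- ℚᵘ does not normalise, so (1/1 + p/(q+1)) * (c/1) is literally
  -- ((1 * (q+1) + p * 1) * c) / ((1 * (q+1)) * 1).
  x/1≤[1+p/q]*c/1 : ∀ {x c p q} → x * suc q ≤ (suc q + p) * c →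
    mkℚᵘ (+ x) 0 ≤ᵘ (1ℚᵘ ℚᵘ.+ mkℚᵘ (+ p) q) ℚᵘ.* mkℚᵘ (+ c) 0
  x/1≤[1+p/q]*c/1 {x} {c} {p} {q} h = *≤* (begin
    + x *ℤ + ((1 * suc q) * 1)                          ≡⟨ pos-* x _ ⟨
    + (x * ((1 * suc q) * 1))                           ≡⟨ cong (λ d → + (x * d)) 1*[1+q]*1≡1+q ⟩
    + (x * suc q)                                       ≤⟨ +≤+ h ⟩
    + ((suc q + p) * c)                                 ≡⟨ pos-* (suc q + p) c ⟩
    + (suc q + p) *ℤ + c                                ≡⟨ cong (_*ℤ + c) (pos-+ (suc q) p) ⟩
    (+ suc q +ℤ + p) *ℤ + c                             ≡⟨ cong (_*ℤ + c) 1*[1+q]+p*1≡1+q+p ⟨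
    (+ 1 *ℤ + suc q +ℤ + p *ℤ + 1) *ℤ + c               ≡⟨ ℤ.*-identityʳ _ ⟨
    ((+ 1 *ℤ + suc q +ℤ + p *ℤ + 1) *ℤ + c) *ℤ + 1      ∎)
    where
    open ℤ.≤-Reasoning
    1*[1+q]*1≡1+q : (1 * suc q) * 1 ≡ suc q
    1*[1+q]*1≡1+q = trans (*-identityʳ (1 * suc q)) (*-identityˡ (suc q))
    1*[1+q]+p*1≡1+q+p : + 1 *ℤ + suc q +ℤ + p *ℤ + 1 ≡ + suc q +ℤ + p
    1*[1+q]+p*1≡1+q+p = cong₂ _+ℤ_ (ℤ.*-identityˡ (+ suc q)) (ℤ.*-identityʳ (+ p))

  ℕtoℚ-≤-[1+ε]* : ∀ {x c p q} .{cop : Coprime p (suc q)} → x * suc q ≤ (suc q + p) * c →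
    ℕtoℚ x ℚ.≤ (1ℚ ℚ.+ mkℚ (+ p) q cop) ℚ.* ℕtoℚ c
  ℕtoℚ-≤-[1+ε]* {x} {c} {p} {q} {cop} h = ℚ.toℚᵘ-cancel-≤ (begin
    toℚᵘ (ℕtoℚ x)                                    ≃⟨ toℚᵘ-ℕtoℚ x ⟩
    mkℚᵘ (+ x) 0                                     ≤⟨ x/1≤[1+p/q]*c/1 h ⟩
    (1ℚᵘ ℚᵘ.+ mkℚᵘ (+ p) q) ℚᵘ.* mkℚᵘ (+ c) 0        ≃⟨ ℚᵘ.*-congˡ {1ℚᵘ ℚᵘ.+ mkℚᵘ (+ p) q} (toℚᵘ-ℕtoℚ c) ⟨
    (1ℚᵘ ℚᵘ.+ mkℚᵘ (+ p) q) ℚᵘ.* toℚᵘ (ℕtoℚ c)       ≃⟨ ℚᵘ.*-congʳ (ℚ.toℚᵘ-homo-+ 1ℚ ε) ⟨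
    toℚᵘ (1ℚ ℚ.+ ε) ℚᵘ.* toℚᵘ (ℕtoℚ c)               ≃⟨ ℚ.toℚᵘ-homo-* (1ℚ ℚ.+ ε) (ℕtoℚ c) ⟨
    toℚᵘ ((1ℚ ℚ.+ ε) ℚ.* ℕtoℚ c)                     ∎)
    where
    open ℚᵘ.≤-Reasoning
    ε = mkℚ (+ p) q cop

  [1-ε]*≤ : ∀ {ε} x .{{_ : NonNegative x}} → 0ℚ ℚ.≤ ε → (1ℚ ℚ.- ε) ℚ.* x ℚ.≤ x
  [1-ε]*≤ {ε} x 0≤ε = begin
    (1ℚ ℚ.- ε) ℚ.* x   ≤⟨ ℚ.*-monoʳ-≤-nonNeg x (ℚ.+-monoʳ-≤ 1ℚ (ℚ.neg-antimono-≤ 0≤ε)) ⟩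
    1ℚ ℚ.* x           ≡⟨ ℚ.*-identityˡ x ⟩
    x                  ∎
    where open ℚ.≤-Reasoning

n*[1+q]≤nC2 : ∀ {m q} → 2 * suc q ≤ m → suc m * suc q ≤ suc m C 2
n*[1+q]≤nC2 {m} {q} 2[1+q]≤m = *-cancelˡ-≤ 2 (begin
  2 * (suc m * suc q)   ≡⟨ solve (m ∷ q ∷ []) ⟩
  suc m * (2 * suc q)   ≤⟨ *-monoʳ-≤ (suc m) 2[1+q]≤m ⟩
  suc m * m             ≡⟨ *-comm (suc m) m ⟩
  m * suc m             ≡⟨ 2*[1+n]C2≡n*[1+n] m ⟨
  2 * (suc m C 2)       ∎)
  where open ≤-Reasoning

free⇒totalEdges≤[1+p/q]*nC2 : ∀ {m q} p → 2 * suc q ≤ m → (G : Graph2 (suc m)) → Free T G →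
  totalEdges G * suc q ≤ (suc q + suc p) * (suc m C 2)
free⇒totalEdges≤[1+p/q]*nC2 {m} {q} p 2[1+q]≤m G free = begin
  totalEdges G * suc q          ≤⟨ *-monoˡ-≤ (suc q) (free⇒totalEdges≤ G free) ⟩
  (suc (suc m) C 2) * suc q     ≡⟨ cong (_* suc q) ([1+n]C2≡n+nC2 (suc m)) ⟩
  (suc m + c) * suc q           ≡⟨ *-distribʳ-+ (suc q) (suc m) c ⟩
  suc m * suc q + c * suc q     ≤⟨ +-monoˡ-≤ (c * suc q) (n*[1+q]≤nC2 2[1+q]≤m) ⟩
  c + c * suc q                 ≤⟨ m≤m+n (c + c * suc q) (p * c) ⟩
  c + c * suc q + p * c         ≡⟨ regroup c ⟩
  (suc q + suc p) * c           ∎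
  where
  open ≤-Reasoning
  c : ℕ
  c = suc m C 2
  regroup : ∀ x → x + x * suc q + p * x ≡ (suc q + suc p) * x
  regroup x = solve (x ∷ q ∷ p ∷ [])

-- For ε = (p+1)/(q+1) the window n > 2 (q+1) makes n (q+1) ≤ C(n,2), i.e. n ≤ ε C(n,2).
degenerate : Degenerate T
degenerate (mkℚ +0 _ _) (ℚ.*<* (+<+ ()))
degenerate (mkℚ -[1+ _ ] _ _) (ℚ.*<* ())
degenerate ε@(mkℚ +[1+ p ] q ε-coprime) 0<ε = suc (2 * suc q) , λ where
  (suc m) (s≤s 2[1+q]≤m) →
    ≤-trans (s≤s (s≤s z≤n)) (s≤s 2[1+q]≤m) ,
    (λ G free → ℕtoℚ-≤-[1+ε]* {totalEdges G} {suc m C 2} {suc p} {q} {ε-coprime}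
      (free⇒totalEdges≤[1+p/q]*nC2 p 2[1+q]≤m G free)) ,
    completeRed (suc m) , completeRed-free (suc m) ,
    subst (λ e → (1ℚ ℚ.- ε) ℚ.* ℕtoℚ (suc m C 2) ℚ.≤ ℕtoℚ e) (sym (totalEdges-completeRed m))
      ([1-ε]*≤ (ℕtoℚ (suc m C 2)) {{ℚ.normalize-nonNeg (suc m C 2) 1}} (ℚ.<⇒≤ 0<ε))

mainTheorem9 : ((n : ℕ) → 1 ≤ n → (G : Graph2 n) → Free T G →
                 totalEdges G ≤ suc n C 2)
               × Degenerate T
mainTheorem9 = (λ n _ → free⇒totalEdges≤) , degenerate
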